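{- Consider an undirected graph $G=(V,E)$ with edge costs $c\ge0$, a set $U\subseteq V\times V$ of pairs, an integer $k\ge1$, a value $T>0$, and constants $\beta,\gamma>0$ with $\gamma\le\beta/2$. Run the following procedure: set $S_r,S_f,W\gets\emptyset$; while there is a pair $(s,t)\in U$ with $d_{G/(S_r\cup S_f)}(s,t)>\beta T/k$: add $(s,t)$ to $S_r$; then if $d_G(s,w)<\gamma T/k$ for some $w\in W$ add $(s,w)$ to $S_f$, else add $s$ to $W$; then if $d_G(t,w')<\gamma T/k$ for some $w'\in W$ add $(t,w')$ to $S_f$, else add $t$ to $W$. Then at termination, the minimum cost of a Steiner forest connecting every pair in $S_r$ is at least $|W|\cdot\frac{\gamma}{2}\cdot\frac{T}{k}$.
   Context: $d_G$ is the shortest-path distance w.r.t. $c$. For a set $P$ of vertex pairs, $G/P$ is the graph obtained from $G$ by identifying the two vertices of each pair in $P$, and $d_{G/P}$ its shortest-path distance. A Steiner forest for a set of pairs is an edge set in which each pair is connected.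
   Formalization: The edge costs $c$ and the parameters $T$, $\beta$, $\gamma$ take rational values. -}

module Defs where

open import Data.Nat as ℕ using (ℕ; NonZero)
open import Data.Integer using (+_)
open import Data.Rational using (ℚ; 0ℚ; _+_; _*_; _/_; _≤_; _<_)
open import Data.Fin using (Fin)
open import Data.Fin.Subset using (Subset; ⊥; _∪_; ⁅_⁆; ∣_∣)
open import Data.Vec using (lookup)
open import Data.Bool using (if_then_else_)
open import Data.List using (List; []; _∷_; _++_; map; foldr; allFin)
open import Data.List.Membership.Propositional using () renaming (_∈_ to _∈ˡ_)
open import Data.Product using (_×_; _,_; Σ; ∃)
open import Data.Sum using (_⊎_)
open import Data.Unit using (⊤)
open import Relation.Nullary using (¬_)
open import Relation.Binary.PropositionalEquality using (_≡_)
open import Relation.Binary.Construct.Closure.Equivalence using (EqClosure)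
open import Relation.Binary.Construct.Closure.ReflexiveTransitive using (Star)

record Graph (n m : ℕ) : Set where
  field
    ends    : Fin m → Fin n × Fin n
    cost    : Fin m → ℚ
    cost≥0  : ∀ e → 0ℚ ≤ cost e

open Graph public

Pair : ℕ → Set
Pair n = Fin n × Fin n

sumℚ : List ℚ → ℚ
sumℚ = foldr _+_ 0ℚ

module _ {n m : ℕ} (G : Graph n m) where

  Joins : Fin m → Fin n → Fin n → Set
  Joins e u z = (ends G e ≡ (u , z)) ⊎ (ends G e ≡ (z , u))

  -- Walks from x to y using only edges satisfying `allowed`, in the graph
  -- obtained from G by identifying vertices related by the equivalence `_~_`.
  -- Indexed by the list of edges traversed.
  data Walk (_~_ : Fin n → Fin n → Set) (allowed : Fin m → Set)
            : Fin n → Fin n → List (Fin m) → Set where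
    stop : ∀ {x y} → x ~ y → Walk _~_ allowed x y []
    step : ∀ {x u z y e es} → x ~ u → allowed e → Joins e u z →
           Walk _~_ allowed z y es → Walk _~_ allowed x y (e ∷ es)

  walkCost : List (Fin m) → ℚ
  walkCost es = sumℚ (map (cost G) es)

  Identified : List (Pair n) → Fin n → Fin n → Set
  Identified P = EqClosure (λ x y → (x , y) ∈ˡ P)

  WalkG : Fin n → Fin n → List (Fin m) → Set
  WalkG = Walk _≡_ (λ _ → ⊤)

  WalkGP : List (Pair n) → Fin n → Fin n → List (Fin m) → Set
  WalkGP P = Walk (Identified P) (λ _ → ⊤)

-- extended rationals for distances (∞ = disconnected)
data ℚ∞ : Set where
  fin : ℚ → ℚ∞
  ∞   : ℚ∞

data _<∞_ : ℚ∞ → ℚ∞ → Set where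
  fin<fin : ∀ {p q} → p < q → fin p <∞ fin q
  fin<∞   : ∀ {p} → fin p <∞ ∞

data IsDist {n m : ℕ} (G : Graph n m)
            (W : Fin n → Fin n → List (Fin m) → Set) (s t : Fin n) : ℚ∞ → Set where
  finite   : ∀ {q} (es : List (Fin m)) → W s t es → walkCost G es ≡ q →
             (∀ es′ → W s t es′ → q ≤ walkCost G es′) → IsDist G W s t (fin q)
  infinite : (∀ es → ¬ W s t es) → IsDist G W s t ∞

module _ {n m : ℕ} (G : Graph n m) where

  dG : Fin n → Fin n → ℚ∞ → Set
  dG = IsDist G (WalkG G)

  dGP : List (Pair n) → Fin n → Fin n → ℚ∞ → Set
  dGP P = IsDist G (WalkGP G P)

  edgeSetCost : Subset m → ℚ
  edgeSetCost F = sumℚ (map (λ e → if lookup F e then cost G e else 0ℚ) (allFin m))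

  SteinerForest : List (Pair n) → Subset m → Set
  SteinerForest S F = ∀ {s t} → (s , t) ∈ˡ S →
    ∃ λ es → Walk G _≡_ (λ e → lookup F e ≡ Data.Bool.true) s t es

-- The procedure (nondeterministic: any choice of violated pair and of w ∈ W).

record State (n : ℕ) : Set where
  constructor ⟨_,_,_⟩
  field
    Sr : List (Pair n)
    Sf : List (Pair n)
    Wv : Subset n

open State public

initState : ∀ {n} → State n
initState = ⟨ [] , [] , ⊥ ⟩

module Procedure {n m : ℕ} (G : Graph n m) (U : List (Pair n))
                 (farThr nearThr : ℚ) where
  -- farThr = β T / k ,  nearThr = γ T / k

  Near : Fin n → Fin n → Set
  Near v w = ∃ λ d → dG G v w d × (d <∞ fin nearThr)

  Far : List (Pair n) → Fin n → Fin n → Set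
  Far P s t = ∃ λ d → dGP G P s t d × (fin farThr <∞ d)

  data Handle (v : Fin n) : List (Pair n) → Subset n →
                            List (Pair n) → Subset n → Set where
    attach : ∀ {Sf W w} → lookup W w ≡ Data.Bool.true → Near v w →
             Handle v Sf W (Sf ++ ((v , w) ∷ [])) W
    newW   : ∀ {Sf W} → (∀ w → lookup W w ≡ Data.Bool.true → ¬ Near v w) →
             Handle v Sf W Sf (W ∪ ⁅ v ⁆)

  data Step : State n → State n → Set where
    iter : ∀ {Sr Sf W Sf₁ W₁ Sf₂ W₂ s t} →
           (s , t) ∈ˡ U → Far (Sr ++ Sf) s t →
           Handle s Sf W Sf₁ W₁ →
           Handle t Sf₁ W₁ Sf₂ W₂ →
           Step ⟨ Sr , Sf , W ⟩ ⟨ Sr ++ ((s , t) ∷ []) , Sf₂ , W₂ ⟩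

  Reachable : State n → Set
  Reachable = Star Step initState

  Terminated : State n → Set
  Terminated σ = ∀ {s t} → (s , t) ∈ˡ U → ¬ Far (Sr σ ++ Sf σ) s t

_per_ : ℚ → (k : ℕ) → .{{NonZero k}} → ℚ
x per k = x * (+ 1 / k)

{-# OPTIONS --safe #-}
module Submission where

-- Put r = γT/(2k). The loop keeps the vertices of W pairwise at G-distance at least 2r = γT/k,
-- and keeps every w ∈ W an endpoint of a pair of S_r at G-distance more than βT/k ≥ r.
-- Draw around each w ∈ W the moat of radius r, and charge an edge e = ab to w for the part of e
-- inside that moat, min (c e, (r − δ w a) + (r − δ w b)) with δ = min (d_G, r). Telescoping δ w
-- along a simple F-path from w to a vertex outside its moat shows that w is charged at least r;
-- since the moats are disjoint, no edge is charged more than its cost in total. Summing over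
-- W × F gives |W| · r ≤ c(F).

open import Defs
open import Data.Nat using (ℕ; zero; suc; NonZero)
import Data.Nat as ℕ
import Data.Nat.Properties as ℕ
import Data.Nat.Coprimality as Coprime
open import Data.Integer using (+_)
import Data.Integer as ℤ
import Data.Integer.Properties as ℤ
open import Data.Rational using (ℚ; 0ℚ; 1ℚ; ½; _+_; _*_; _-_; -_; _/_; _≤_; _<_; _⊓_; mkℚ)
import Data.Rational as ℚ using (NonNegative; nonNegative)
import Data.Rational.Properties as ℚ
open import Data.Rational.Solver using (module +-*-Solver)
open import Algebra.Properties.CommutativeMonoid.Sum ℚ.+-0-commutativeMonoid
  using (sum; ∑-comm; sum-cong-≗; sum-replicate-zero)
open import Data.Bool using (true; false; if_then_else_)
import Data.Bool as Bool
open import Data.Fin using (Fin; zero; suc; _≟_)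
import Data.Fin.Properties as Fin
open import Data.Fin.Subset using (Subset; ∣_∣; _∪_; ⁅_⁆; ⊥)
open import Data.Fin.Subset.Properties using (x∈p∪q⁻; x∈⁅y⁆⇒x≡y)
open import Data.Vec using ([]; _∷_) renaming (lookup to _‼_)
open import Data.Vec.Properties using ([]=⇒lookup; lookup⇒[]=; lookup-replicate)
open import Data.List using (List; []; _∷_; _++_; map; allFin; tabulate; length; cartesianProductWith)
import Data.List as List
import Data.List.Properties as List
open import Data.List.Membership.Propositional using (_∈_)
open import Data.List.Membership.Propositional.Properties
  using (∈-lookup; ∈-allFin; ∈-cartesianProductWith⁺; ∈-++⁺ˡ; ∈-++⁺ʳ)
open import Data.List.Relation.Unary.Any using (here; there)
import Data.List.Relation.Unary.All as All
open import Data.List.Relation.Unary.All.Properties.Core using (¬Any⇒All¬)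
open import Data.List.Relation.Unary.Unique.Propositional using (Unique; []; _∷_)
open import Data.Product using (_×_; _,_; ∃; proj₁; proj₂)
open import Data.Sum using (_⊎_; inj₁; inj₂)
import Data.Sum as Sum
open import Data.Unit using (tt)
open import Function using (_∘_; flip)
open import Relation.Nullary using (¬_; Dec; does; yes; no; contradiction)
open import Relation.Nullary.Decidable using (dec-false; _×-dec_; _⊎-dec_)
import Relation.Nullary.Decidable as Dec
open import Relation.Binary.PropositionalEquality
open import Relation.Binary.Construct.Closure.ReflexiveTransitive using (Star; ε; _◅_)

open +-*-Solver

module ≤-Reasoning = ℚ.≤-Reasoning hiding (stop)

x≤x+y : ∀ {x y} → 0ℚ ≤ y → x ≤ x + y
x≤x+y {x} {y} 0≤y = subst (_≤ x + y) (ℚ.+-identityʳ x) (ℚ.+-monoʳ-≤ x 0≤y)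

x≤y+x : ∀ {x y} → 0ℚ ≤ y → x ≤ y + x
x≤y+x {x} {y} 0≤y = subst (_≤ y + x) (ℚ.+-identityˡ x) (ℚ.+-monoˡ-≤ x 0≤y)

≤⇒0≤- : ∀ {x y} → x ≤ y → 0ℚ ≤ y - x
≤⇒0≤- {x} {y} x≤y = subst (_≤ y - x) (ℚ.+-inverseʳ x) (ℚ.+-monoˡ-≤ (- x) x≤y)

≤⇒-≤0 : ∀ {x y} → x ≤ y → x - y ≤ 0ℚ
≤⇒-≤0 {x} {y} x≤y = subst (x - y ≤_) (ℚ.+-inverseʳ y) (ℚ.+-monoˡ-≤ (- y) x≤y)

≤+⇒-≤ : ∀ {x y z} → x ≤ y + z → x - y ≤ z
≤+⇒-≤ {x} {y} {z} x≤y+z =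
  subst (x - y ≤_) (solve 2 (λ y z → (y :+ z) :- y := z) refl y z) (ℚ.+-monoˡ-≤ (- y) x≤y+z)

sum-mono-≤ : ∀ {k} {f g : Fin k → ℚ} → (∀ i → f i ≤ g i) → sum f ≤ sum g
sum-mono-≤ {zero}  f≤g = ℚ.≤-refl
sum-mono-≤ {suc k} f≤g = ℚ.+-mono-≤ (f≤g zero) (sum-mono-≤ (f≤g ∘ suc))

sum-nonPos : ∀ {k} {f : Fin k → ℚ} → (∀ i → f i ≤ 0ℚ) → sum f ≤ 0ℚ
sum-nonPos {k} {f} f≤0 = subst (sum f ≤_) (sum-replicate-zero k) (sum-mono-≤ f≤0)

sum-nonNeg : ∀ {k} {f : Fin k → ℚ} → (∀ i → 0ℚ ≤ f i) → 0ℚ ≤ sum f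
sum-nonNeg {k} {f} 0≤f = subst (_≤ sum f) (sum-replicate-zero k) (sum-mono-≤ 0≤f)

zeroAt : ∀ {k} → Fin k → (Fin k → ℚ) → Fin k → ℚ
zeroAt i f j = if does (j ≟ i) then 0ℚ else f j

zeroAt-≢ : ∀ {k} {i j : Fin k} (f : Fin k → ℚ) → j ≢ i → zeroAt i f j ≡ f j
zeroAt-≢ {i = i} {j} f j≢i rewrite dec-false (j ≟ i) j≢i = refl

zeroAt-elim : ∀ {k} (P : ℚ → Set) (i : Fin k) (f : Fin k → ℚ) j → P 0ℚ → (j ≢ i → P (f j)) →
              P (zeroAt i f j)
zeroAt-elim P i f j p0 pf with j ≟ i
... | yes _   = p0
... | no j≢i = pf j≢i

sum-split : ∀ {k} (i : Fin k) (f : Fin k → ℚ) → sum f ≡ f i + sum (zeroAt i f)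
sum-split zero    f = cong (_+_ (f zero)) (sym (ℚ.+-identityˡ _))
sum-split (suc i) f =
  trans (cong (_+_ (f zero)) (sum-split i (f ∘ suc)))
        (solve 3 (λ a b c → a :+ (b :+ c) := b :+ (a :+ c)) refl (f zero) (f (suc i)) _)

sum-≤-at : ∀ {k} (i : Fin k) {f : Fin k → ℚ} → (∀ j → j ≢ i → f j ≤ 0ℚ) → sum f ≤ f i
sum-≤-at i {f} f≤0 = begin
  sum f                   ≡⟨ sum-split i f ⟩
  f i + sum (zeroAt i f)  ≤⟨ ℚ.+-monoʳ-≤ (f i) (sum-nonPos λ j → zeroAt-elim (_≤ 0ℚ) i f j ℚ.≤-refl (f≤0 j)) ⟩
  f i + 0ℚ                ≡⟨ ℚ.+-identityʳ (f i) ⟩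
  f i                     ∎
  where open ≤-Reasoning

sum-≤-pair : ∀ {k} {i i′ : Fin k} {f : Fin k → ℚ} → i ≢ i′ →
             (∀ j → j ≢ i → j ≢ i′ → f j ≤ 0ℚ) → sum f ≤ f i + f i′
sum-≤-pair {i = i} {i′} {f} i≢i′ f≤0 = begin
  sum f                   ≡⟨ sum-split i f ⟩
  f i + sum (zeroAt i f)  ≤⟨ ℚ.+-monoʳ-≤ (f i) (sum-≤-at i′ λ j j≢i′ →
                               zeroAt-elim (_≤ 0ℚ) i f j ℚ.≤-refl λ j≢i → f≤0 j j≢i j≢i′) ⟩
  f i + zeroAt i f i′     ≡⟨ cong (_+_ (f i)) (zeroAt-≢ f (i≢i′ ∘ sym)) ⟩
  f i + f i′              ∎
  where open ≤-Reasoning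

sumℚ-≤-sum : ∀ {k} {h g : Fin k → ℚ} {xs : List (Fin k)} → Unique xs →
             (∀ i → 0ℚ ≤ g i) → (∀ {i} → i ∈ xs → h i ≤ g i) → sumℚ (map h xs) ≤ sum g
sumℚ-≤-sum {xs = []} _ 0≤g _ = sum-nonNeg 0≤g
sumℚ-≤-sum {h = h} {g} {x ∷ xs} (x∉xs ∷ unique) 0≤g h≤g = begin
  h x + sumℚ (map h xs)   ≤⟨ ℚ.+-mono-≤ (h≤g (here refl)) (sumℚ-≤-sum unique 0≤g′ h≤g′) ⟩
  g x + sum (zeroAt x g)  ≡⟨ sum-split x g ⟨
  sum g                   ∎
  where
  open ≤-Reasoning
  0≤g′ : ∀ i → 0ℚ ≤ zeroAt x g i
  0≤g′ i = zeroAt-elim (0ℚ ≤_) x g i ℚ.≤-refl (λ _ → 0≤g i)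
  h≤g′ : ∀ {i} → i ∈ xs → h i ≤ zeroAt x g i
  h≤g′ {i} i∈xs = subst (h i ≤_) (sym (zeroAt-≢ g (All.lookup x∉xs i∈xs ∘ sym))) (h≤g (there i∈xs))

sumℚ-allFin : ∀ {k} (f : Fin k → ℚ) → sumℚ (map f (allFin k)) ≡ sum f
sumℚ-allFin {k} f = trans (cong sumℚ (List.map-tabulate (λ i → i) f)) (sumℚ-tabulate f)
  where
  sumℚ-tabulate : ∀ {k} (f : Fin k → ℚ) → sumℚ (tabulate f) ≡ sum f
  sumℚ-tabulate {zero}  f = refl
  sumℚ-tabulate {suc k} f = cong (_+_ (f zero)) (sumℚ-tabulate (f ∘ suc))

restrict : ∀ {k} → Subset k → (Fin k → ℚ) → Fin k → ℚ
restrict S f i = if S ‼ i then f i else 0ℚ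

restrict-∈ : ∀ {k} (S : Subset k) (f : Fin k → ℚ) {i} → S ‼ i ≡ true → restrict S f i ≡ f i
restrict-∈ S f i∈S rewrite i∈S = refl

restrict-mono-≤ : ∀ {k} (S : Subset k) {f g : Fin k → ℚ} →
                  (∀ i → S ‼ i ≡ true → f i ≤ g i) → ∀ i → restrict S f i ≤ restrict S g i
restrict-mono-≤ S f≤g i with S ‼ i in i∈S
... | true  = f≤g i i∈S
... | false = ℚ.≤-refl

restrict-nonNeg : ∀ {k} (S : Subset k) {f : Fin k → ℚ} → (∀ i → 0ℚ ≤ f i) → ∀ i → 0ℚ ≤ restrict S f i
restrict-nonNeg S 0≤f i with S ‼ i
... | true  = 0≤f i
... | false = ℚ.≤-refl

restrict-≤ : ∀ {k} (S : Subset k) (f : Fin k → ℚ) {i x} → 0ℚ ≤ x → (S ‼ i ≡ true → f i ≤ x) →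
             restrict S f i ≤ x
restrict-≤ S f {i} 0≤x f≤x with S ‼ i
... | true  = f≤x refl
... | false = 0≤x

sum-restrict-const : ∀ {k} (S : Subset k) (x : ℚ) → sum (restrict S (λ _ → x)) ≡ (+ ∣ S ∣ / 1) * x
sum-restrict-const []          x = sym (ℚ.*-zeroˡ x)
sum-restrict-const (false ∷ S) x = trans (ℚ.+-identityˡ _) (sum-restrict-const S x)
sum-restrict-const (true ∷ S)  x = begin
  x + sum (restrict S (λ _ → x))  ≡⟨ cong (_+_ x) (sum-restrict-const S x) ⟩
  x + (+ ∣ S ∣ / 1) * x           ≡⟨ solve 2 (λ c x → x :+ c :* x := (con 1ℚ :+ c) :* x) refl (+ ∣ S ∣ / 1) x ⟩
  (1ℚ + + ∣ S ∣ / 1) * x          ≡⟨ cong (_* x) (suc/1 ∣ S ∣) ⟨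
  (+ suc ∣ S ∣ / 1) * x           ∎
  where
  open ≡-Reasoning
  -- `_/_` normalises through a gcd, which does not compute on a variable numerator.
  n/1 : ∀ n → + n / 1 ≡ mkℚ (+ n) 0 (Coprime.sym (Coprime.1-coprimeTo n))
  n/1 n = ℚ.normalize-coprime (Coprime.sym (Coprime.1-coprimeTo n))
  suc/1 : ∀ n → + suc n / 1 ≡ 1ℚ + + n / 1
  suc/1 n rewrite n/1 n = cong (λ i → i / 1) (cong (ℤ._+_ (+ 1)) (sym (ℤ.*-identityʳ (+ n))))

sum-restrict-comm : ∀ {k l} (S : Subset k) (T : Subset l) (h : Fin k → Fin l → ℚ) →
  sum (restrict S (λ i → sum (restrict T (h i)))) ≡ sum (restrict T (λ j → sum (restrict S (λ i → h i j))))
sum-restrict-comm S T h = begin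
  sum (restrict S (λ i → sum (restrict T (h i))))
    ≡⟨ sum-cong-≗ (λ i → if-sum (S ‼ i) (restrict T (h i))) ⟩
  sum (λ i → sum (λ j → restrict S (λ i → restrict T (h i) j) i))
    ≡⟨ ∑-comm (λ i j → restrict S (λ i → restrict T (h i) j) i) ⟩
  sum (λ j → sum (λ i → restrict S (λ i → restrict T (h i) j) i))
    ≡⟨ sum-cong-≗ (λ j → sum-cong-≗ (λ i → if-swap (S ‼ i) (T ‼ j))) ⟩
  sum (λ j → sum (λ i → restrict T (λ j → restrict S (λ i → h i j) i) j))
    ≡⟨ sum-cong-≗ (λ j → if-sum (T ‼ j) (restrict S (λ i → h i j))) ⟨
  sum (restrict T (λ j → sum (restrict S (λ i → h i j))))
    ∎
  where
  open ≡-Reasoning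
  if-sum : ∀ {n} b (f : Fin n → ℚ) → (if b then sum f else 0ℚ) ≡ sum (λ i → if b then f i else 0ℚ)
  if-sum true      f = refl
  if-sum {n} false f = sym (sum-replicate-zero n)
  if-swap : ∀ a b {x} → (if a then (if b then x else 0ℚ) else 0ℚ) ≡ (if b then (if a then x else 0ℚ) else 0ℚ)
  if-swap true  b     = refl
  if-swap false true  = refl
  if-swap false false = refl

module _ {a p} {X : Set a} {P : X → Set p} (P? : ∀ x → Dec (P x)) (f : X → ℚ) where

  least-or-none : (xs : List X) →
    (∀ {x} → x ∈ xs → ¬ P x) ⊎ (∃ λ x → P x × ∀ {y} → y ∈ xs → P y → f x ≤ f y)
  least-or-none [] = inj₁ λ ()
  least-or-none (x ∷ xs) with P? x | least-or-none xs
  ... | no ¬px | inj₁ none = inj₁ λ { (here refl) → ¬px ; (there y∈xs) → none y∈xs }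
  ... | no ¬px | inj₂ (z , pz , least) =
    inj₂ (z , pz , λ { (here refl) py → contradiction py ¬px ; (there y∈xs) → least y∈xs })
  ... | yes px | inj₁ none =
    inj₂ (x , px , λ { (here refl) _ → ℚ.≤-refl ; (there y∈xs) py → contradiction py (none y∈xs) })
  ... | yes px | inj₂ (z , pz , least) with ℚ.≤-total (f x) (f z)
  ...   | inj₁ x≤z =
    inj₂ (x , px , λ { (here refl) _ → ℚ.≤-refl ; (there y∈xs) py → ℚ.≤-trans x≤z (least y∈xs py) })
  ...   | inj₂ z≤x = inj₂ (z , pz , λ { (here refl) _ → z≤x ; (there y∈xs) py → least y∈xs py })

Unique⇒length≤ : ∀ {k} {xs : List (Fin k)} → Unique xs → length xs ℕ.≤ k
Unique⇒length≤ unique = Fin.injective⇒≤ (lookup-injective unique)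
  where
  lookup-injective : ∀ {k} {xs : List (Fin k)} → Unique xs →
                     ∀ {i j} → List.lookup xs i ≡ List.lookup xs j → i ≡ j
  lookup-injective (_ ∷ _)  {zero}  {zero}  _ = refl
  lookup-injective (x∉ ∷ _) {zero}  {suc j} x≡ = contradiction x≡ (All.lookup x∉ (∈-lookup j))
  lookup-injective (x∉ ∷ _) {suc i} {zero}  ≡x = contradiction (sym ≡x) (All.lookup x∉ (∈-lookup i))
  lookup-injective (_ ∷ unique) {suc i} {suc j} eq = cong suc (lookup-injective unique eq)

∈-∪⁅⁆⁻ : ∀ {k} (S : Subset k) (v : Fin k) {x} → (S ∪ ⁅ v ⁆) ‼ x ≡ true → S ‼ x ≡ true ⊎ x ≡ v
∈-∪⁅⁆⁻ S v {x} x∈ =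
  Sum.map []=⇒lookup (x∈⁅y⁆⇒x≡y v) (x∈p∪q⁻ S ⁅ v ⁆ (lookup⇒[]= x (S ∪ ⁅ v ⁆) x∈))

module Walks {n m : ℕ} (G : Graph n m) where

  open import Data.List.Membership.DecPropositional (Fin._≟_ {n}) using (_∈?_)

  WalkIn : (Fin m → Set) → Fin n → Fin n → List (Fin m) → Set
  WalkIn = Walk G _≡_

  walkCost-++ : ∀ es fs → walkCost G (es ++ fs) ≡ walkCost G es + walkCost G fs
  walkCost-++ []       fs = sym (ℚ.+-identityˡ _)
  walkCost-++ (e ∷ es) fs =
    trans (cong (_+_ (cost G e)) (walkCost-++ es fs)) (sym (ℚ.+-assoc (cost G e) _ _))

  Joins-sym : ∀ {e u z} → Joins G e u z → Joins G e z u
  Joins-sym (inj₁ p) = inj₂ p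
  Joins-sym (inj₂ p) = inj₁ p

  Joins-endpoint : ∀ {e u z u′ z′} → Joins G e u z → Joins G e u′ z′ → u ≡ u′ ⊎ u ≡ z′
  Joins-endpoint (inj₁ p) (inj₁ q) = inj₁ (cong proj₁ (trans (sym p) q))
  Joins-endpoint (inj₁ p) (inj₂ q) = inj₂ (cong proj₁ (trans (sym p) q))
  Joins-endpoint (inj₂ p) (inj₁ q) = inj₂ (cong proj₂ (trans (sym p) q))
  Joins-endpoint (inj₂ p) (inj₂ q) = inj₁ (cong proj₂ (trans (sym p) q))

  liftToQuotient : ∀ {P x y es} → WalkG G x y es → WalkGP G P x y es
  liftToQuotient (stop refl)       = stop ε
  liftToQuotient (step refl _ j w) = step ε tt j (liftToQuotient w)

  walk? : ∀ x y es → Dec (WalkG G x y es)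
  walk? x y [] = Dec.map′ stop (λ { (stop x≡y) → x≡y }) (x Fin.≟ y)
  walk? x y (e ∷ es) with ends G e in ends≡
  ... | (a , b) = Dec.map′ toWalk fromWalk
        ((x Fin.≟ a ×-dec walk? b y es) ⊎-dec (x Fin.≟ b ×-dec walk? a y es))
    where
    toWalk : (x ≡ a × WalkG G b y es) ⊎ (x ≡ b × WalkG G a y es) → WalkG G x y (e ∷ es)
    toWalk (inj₁ (refl , w)) = step refl tt (inj₁ ends≡) w
    toWalk (inj₂ (refl , w)) = step refl tt (inj₂ ends≡) w
    fromWalk : WalkG G x y (e ∷ es) → (x ≡ a × WalkG G b y es) ⊎ (x ≡ b × WalkG G a y es)
    fromWalk (step refl tt (inj₁ p) w) with trans (sym ends≡) p
    ... | refl = inj₁ (refl , w)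
    fromWalk (step refl tt (inj₂ p) w) with trans (sym ends≡) p
    ... | refl = inj₂ (refl , w)

  module _ {A : Fin m → Set} where

    infixr 5 _++ʷ_
    _++ʷ_ : ∀ {x y z es fs} → WalkIn A x y es → WalkIn A y z fs → WalkIn A x z (es ++ fs)
    stop refl       ++ʷ w′ = w′
    step refl a j w ++ʷ w′ = step refl a j (w ++ʷ w′)

    reverse : ∀ {x y es} → WalkIn A x y es → ∃ λ fs → WalkIn A y x fs × walkCost G fs ≡ walkCost G es
    reverse (stop refl) = [] , stop refl , refl
    reverse (step {e = e} {es = es} refl a j w) with reverse w
    ... | fs , w⁻¹ , cost≡ =
      fs ++ e ∷ [] , w⁻¹ ++ʷ step refl a (Joins-sym j) (stop refl) , (begin
        walkCost G (fs ++ e ∷ [])          ≡⟨ walkCost-++ fs (e ∷ []) ⟩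
        walkCost G fs + (cost G e + 0ℚ)    ≡⟨ cong₂ _+_ cost≡ (ℚ.+-identityʳ (cost G e)) ⟩
        walkCost G es + cost G e           ≡⟨ ℚ.+-comm (walkCost G es) (cost G e) ⟩
        cost G e + walkCost G es           ∎)
      where open ≡-Reasoning

    vertices : ∀ {x y es} → WalkIn A x y es → List (Fin n)
    vertices {x = x} (stop _)       = x ∷ []
    vertices {x = x} (step _ _ _ w) = x ∷ vertices w

    length-vertices : ∀ {x y es} (w : WalkIn A x y es) → length (vertices w) ≡ suc (length es)
    length-vertices (stop _)       = refl
    length-vertices (step _ _ _ w) = cong suc (length-vertices w)

    source∈vertices : ∀ {x y es} (w : WalkIn A x y es) → x ∈ vertices w
    source∈vertices (stop _)       = here refl
    source∈vertices (step _ _ _ _) = here refl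

    record SimpleWalk (x y : Fin n) (bound : ℚ) : Set where
      field
        edges  : List (Fin m)
        walk   : WalkIn A x y edges
        simple : Unique (vertices walk)
        cost≤  : walkCost G edges ≤ bound

    suffixFrom : ∀ {x y v es b} (w : WalkIn A x y es) → Unique (vertices w) → walkCost G es ≤ b →
                 v ∈ vertices w → SimpleWalk v y b
    suffixFrom w@(stop _)       simple cost≤ (here refl) = record { walk = w ; simple = simple ; cost≤ = cost≤ }
    suffixFrom w@(step _ _ _ _) simple cost≤ (here refl) = record { walk = w ; simple = simple ; cost≤ = cost≤ }
    suffixFrom (step {e = e} _ _ _ w) (_ ∷ simple) cost≤ (there v∈w) =
      suffixFrom w simple (ℚ.≤-trans (x≤y+x (cost≥0 G e)) cost≤) v∈w

    loopErase : ∀ {x y es} → WalkIn A x y es → SimpleWalk x y (walkCost G es)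
    loopErase (stop x≡y) = record { walk = stop x≡y ; simple = All.[] ∷ [] ; cost≤ = ℚ.≤-refl }
    loopErase {x = x} (step {e = e} x≡u a j w) with loopErase w
    ... | erased with x ∈? vertices (SimpleWalk.walk erased)
    ...   | yes x∈ = suffixFrom walk simple (ℚ.≤-trans cost≤ (x≤y+x (cost≥0 G e))) x∈
      where open SimpleWalk erased
    ...   | no x∉ = record { walk   = step x≡u a j walk
                           ; simple = ¬Any⇒All¬ _ x∉ ∷ simple
                           ; cost≤  = ℚ.+-monoʳ-≤ (cost G e) cost≤ }
      where open SimpleWalk erased

    allowed : ∀ {x y es e} → WalkIn A x y es → e ∈ es → A e
    allowed (step _ a _ _) (here refl)  = a
    allowed (step _ _ _ w) (there e∈es) = allowed w e∈es

    endpoint∈vertices : ∀ {x y es e u z} (w : WalkIn A x y es) → e ∈ es → Joins G e u z → u ∈ vertices w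
    endpoint∈vertices (step refl _ j w) (here refl) j′ with Joins-endpoint j′ j
    ... | inj₁ refl = here refl
    ... | inj₂ refl = there (source∈vertices w)
    endpoint∈vertices (step _ _ _ w) (there e∈es) j = there (endpoint∈vertices w e∈es j)

    simple⇒edgesUnique : ∀ {x y es} (w : WalkIn A x y es) → Unique (vertices w) → Unique es
    simple⇒edgesUnique (stop _) _ = []
    simple⇒edgesUnique (step refl _ j w) (x∉w ∷ simple) =
      All.tabulate (λ { e∈w refl → All.lookup x∉w (endpoint∈vertices w e∈w j) refl })
      ∷ simple⇒edgesUnique w simple

  Separated : ℚ → Subset n → Set
  Separated d W = ∀ {w w′} → W ‼ w ≡ true → W ‼ w′ ≡ true → w ≢ w′ →
                  ∀ {es} → WalkG G w w′ es → d ≤ walkCost G es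

  listsUpTo : ℕ → List (List (Fin m))
  listsUpTo zero    = [] ∷ []
  listsUpTo (suc L) = [] ∷ cartesianProductWith _∷_ (allFin m) (listsUpTo L)

  ∈-listsUpTo : ∀ {L} es → length es ℕ.≤ L → es ∈ listsUpTo L
  ∈-listsUpTo {zero}  []       _          = here refl
  ∈-listsUpTo {suc L} []       _          = here refl
  ∈-listsUpTo {suc L} (e ∷ es) (ℕ.s≤s l) =
    there (∈-cartesianProductWith⁺ _∷_ (∈-allFin e) (∈-listsUpTo es l))

  simple⇒edges∈listsUpTo : ∀ {A : Fin m → Set} {x y b} (E : SimpleWalk {A} x y b) →
                           SimpleWalk.edges E ∈ listsUpTo n
  simple⇒edges∈listsUpTo E = ∈-listsUpTo edges
    (ℕ.≤-trans (ℕ.n≤1+n _) (subst (ℕ._≤ n) (length-vertices walk) (Unique⇒length≤ simple)))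
    where open SimpleWalk E

  Shortest : Fin n → Fin n → List (Fin m) → Set
  Shortest x y es = WalkG G x y es × ∀ {fs} → WalkG G x y fs → walkCost G es ≤ walkCost G fs

  shortestWalk : ∀ x y → (∀ es → ¬ WalkG G x y es) ⊎ ∃ (Shortest x y)
  shortestWalk x y with least-or-none (walk? x y) (walkCost G) (listsUpTo n)
  ... | inj₁ none = inj₁ λ es w → let E = loopErase w in none (simple⇒edges∈listsUpTo E) (SimpleWalk.walk E)
  ... | inj₂ (es , w , least) = inj₂ (es , w , λ w′ → let E = loopErase w′ in
    ℚ.≤-trans (least (simple⇒edges∈listsUpTo E) (SimpleWalk.walk E)) (SimpleWalk.cost≤ E))

module Moats {n m : ℕ} (G : Graph n m) (r : ℚ) where

  open Walks G

  record TruncatedDistance (x y : Fin n) (d : ℚ) : Set where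
    field
      ≤radius   : d ≤ r
      ≤walkCost : ∀ {es} → WalkG G x y es → d ≤ walkCost G es
      attained  : d < r → ∃ λ es → WalkG G x y es × walkCost G es ≤ d

  truncatedDistance : ∀ x y → ∃ (TruncatedDistance x y)
  truncatedDistance x y with shortestWalk x y
  ... | inj₁ none = r , record
    { ≤radius   = ℚ.≤-refl
    ; ≤walkCost = λ w → contradiction w (none _)
    ; attained  = λ r<r → contradiction r<r (ℚ.<-irrefl refl) }
  ... | inj₂ (es , w , least) = walkCost G es ⊓ r , record
    { ≤radius   = ℚ.p⊓q≤q (walkCost G es) r
    ; ≤walkCost = λ w′ → ℚ.≤-trans (ℚ.p⊓q≤p _ r) (least w′)
    ; attained  = λ d<r → es , w , ℚ.⊓-glb ℚ.≤-refl (cost≤r d<r) }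
    where
    cost≤r : walkCost G es ⊓ r < r → walkCost G es ≤ r
    cost≤r d<r = ℚ.≮⇒≥ λ r<c → ℚ.<-irrefl (ℚ.p≥q⇒p⊓q≡q (ℚ.<⇒≤ r<c)) d<r

  δ : Fin n → Fin n → ℚ
  δ x y = proj₁ (truncatedDistance x y)

  open module δ-properties {x y : Fin n} = TruncatedDistance (proj₂ (truncatedDistance x y))

  δ-self : ∀ x → δ x x ≤ 0ℚ
  δ-self x = ≤walkCost (stop refl)

  radius≤δ : ∀ {x y} → (∀ {es} → WalkG G x y es → r ≤ walkCost G es) → r ≤ δ x y
  radius≤δ far = ℚ.≮⇒≥ λ δ<r → let (es , w , cost≤δ) = attained δ<r in
    ℚ.<-irrefl refl (ℚ.≤-<-trans (far w) (ℚ.≤-<-trans cost≤δ δ<r))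

  δ-edge : ∀ {w e u z} → Joins G e u z → δ w z ≤ δ w u + cost G e
  δ-edge {w} {e} {u} {z} j with δ w u ℚ.<? r
  ... | yes δ<r = let (es , walk , cost≤δ) = attained δ<r in begin
    δ w z                          ≤⟨ ≤walkCost (walk ++ʷ step refl tt j (stop refl)) ⟩
    walkCost G (es ++ e ∷ [])      ≡⟨ walkCost-++ es (e ∷ []) ⟩
    walkCost G es + (cost G e + 0ℚ) ≡⟨ cong (_+_ (walkCost G es)) (ℚ.+-identityʳ (cost G e)) ⟩
    walkCost G es + cost G e       ≤⟨ ℚ.+-monoˡ-≤ (cost G e) cost≤δ ⟩
    δ w u + cost G e               ∎
    where open ≤-Reasoning
  ... | no δ≮r = ℚ.≤-trans ≤radius (ℚ.≤-trans (ℚ.≮⇒≥ δ≮r) (x≤x+y (cost≥0 G e)))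

  charge : Fin n → Fin m → ℚ
  charge w e = cost G e ⊓ ((r - δ w (proj₁ (ends G e))) + (r - δ w (proj₂ (ends G e))))

  charge-nonNeg : ∀ w e → 0ℚ ≤ charge w e
  charge-nonNeg w e = ℚ.⊓-glb (cost≥0 G e) (ℚ.+-mono-≤ (≤⇒0≤- ≤radius) (≤⇒0≤- ≤radius))

  charge-Joins : ∀ {w e u z} → Joins G e u z → charge w e ≡ cost G e ⊓ ((r - δ w u) + (r - δ w z))
  charge-Joins (inj₁ ends≡) rewrite ends≡ = refl
  charge-Joins {w} {e} {u} {z} (inj₂ ends≡) rewrite ends≡ =
    cong (cost G e ⊓_) (ℚ.+-comm (r - δ w z) (r - δ w u))

  δ-step : ∀ {w e u z} → Joins G e u z → δ w z ≤ δ w u + charge w e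
  δ-step {w} {e} {u} {z} j = begin
    δ w z                                                         ≤⟨ ℚ.⊓-glb (δ-edge j) δ≤boundary ⟩
    (δ w u + cost G e) ⊓ (δ w u + ((r - δ w u) + (r - δ w z)))   ≡⟨ ℚ.mono-≤-distrib-⊓ (ℚ.+-monoʳ-≤ (δ w u)) _ _ ⟨
    δ w u + cost G e ⊓ ((r - δ w u) + (r - δ w z))                ≡⟨ cong (_+_ (δ w u)) (charge-Joins j) ⟨
    δ w u + charge w e                                            ∎
    where
    open ≤-Reasoning
    δ≤boundary : δ w z ≤ δ w u + ((r - δ w u) + (r - δ w z))
    δ≤boundary = subst (δ w z ≤_)
      (solve 3 (λ r a b → r :+ (r :- b) := a :+ ((r :- a) :+ (r :- b))) refl r (δ w u) (δ w z))
      (ℚ.≤-trans ≤radius (x≤x+y (≤⇒0≤- ≤radius)))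

  δ-telescope : ∀ {A : Fin m → Set} {w x y es} → WalkIn A x y es → δ w y ≤ δ w x + sumℚ (map (charge w) es)
  δ-telescope {w = w} {x} (stop refl) = ℚ.≤-reflexive (sym (ℚ.+-identityʳ (δ w x)))
  δ-telescope {w = w} {x} {y} (step {z = z} {e = e} {es = es} refl _ j walk) = begin
    δ w y                                          ≤⟨ δ-telescope walk ⟩
    δ w z + sumℚ (map (charge w) es)               ≤⟨ ℚ.+-monoˡ-≤ _ (δ-step j) ⟩
    δ w x + charge w e + sumℚ (map (charge w) es)  ≡⟨ ℚ.+-assoc (δ w x) (charge w e) _ ⟩
    δ w x + sumℚ (map (charge w) (e ∷ es))         ∎
    where open ≤-Reasoning

  Escapes : Subset m → Fin n → Set
  Escapes F w = ∃ λ y → ∃ (WalkIn (λ e → F ‼ e ≡ true) w y) × (∀ {es} → WalkG G w y es → r ≤ walkCost G es)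

  radius≤forestCharge : ∀ {F w} → Escapes F w → r ≤ sum (restrict F (charge w))
  radius≤forestCharge {F} {w} (y , (es , walk) , far) = begin
    r                                       ≤⟨ radius≤δ far ⟩
    δ w y                                   ≤⟨ δ-telescope (SimpleWalk.walk E) ⟩
    δ w w + sumℚ (map (charge w) edges)     ≤⟨ ℚ.+-monoˡ-≤ _ (δ-self w) ⟩
    0ℚ + sumℚ (map (charge w) edges)        ≡⟨ ℚ.+-identityˡ _ ⟩
    sumℚ (map (charge w) edges)
      ≤⟨ sumℚ-≤-sum (simple⇒edgesUnique walk′ simple) (restrict-nonNeg F (charge-nonNeg w)) inF ⟩
    sum (restrict F (charge w))             ∎
    where
    open ≤-Reasoning
    E : SimpleWalk w y (walkCost G es)
    E = loopErase walk
    open SimpleWalk E renaming (walk to walk′)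
    inF : ∀ {e} → e ∈ edges → charge w e ≤ restrict F (charge w) e
    inF e∈ = ℚ.≤-reflexive (sym (restrict-∈ F (charge w) (allowed walk′ e∈)))

  module _ {W : Subset n} (separated : Separated (r + r) W) where

    InMoat : Fin n → Fin n → Set
    InMoat x w = W ‼ w ≡ true × δ w x < r

    moats-apart : ∀ {x y w₁ w₂ es} → InMoat x w₁ → InMoat y w₂ → w₁ ≢ w₂ → WalkG G x y es →
                  r + r ≤ δ w₁ x + (walkCost G es + δ w₂ y)
    moats-apart {x} {y} {w₁} {w₂} {es} (w₁∈W , δ₁<r) (w₂∈W , δ₂<r) w₁≢w₂ walk
      with attained δ₁<r | attained δ₂<r
    ... | es₁ , walk₁ , cost₁≤ | es₂ , walk₂ , cost₂≤ with reverse walk₂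
    ... | fs₂ , walk₂⁻¹ , cost≡ = begin
      r + r                                        ≤⟨ separated w₁∈W w₂∈W w₁≢w₂ (walk₁ ++ʷ walk ++ʷ walk₂⁻¹) ⟩
      walkCost G (es₁ ++ es ++ fs₂)                ≡⟨ walkCost-++ es₁ (es ++ fs₂) ⟩
      walkCost G es₁ + walkCost G (es ++ fs₂)      ≡⟨ cong (_+_ (walkCost G es₁)) (walkCost-++ es fs₂) ⟩
      walkCost G es₁ + (walkCost G es + walkCost G fs₂)
        ≤⟨ ℚ.+-mono-≤ cost₁≤ (ℚ.+-monoʳ-≤ (walkCost G es) (subst (_≤ δ w₂ y) (sym cost≡) cost₂≤)) ⟩
      δ w₁ x + (walkCost G es + δ w₂ y)            ∎
      where open ≤-Reasoning

    moat-unique : ∀ {x w₁ w₂} → InMoat x w₁ → InMoat x w₂ → w₁ ≡ w₂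
    moat-unique {x} {w₁} {w₂} in₁ in₂ with w₁ Fin.≟ w₂
    ... | yes w₁≡w₂ = w₁≡w₂
    ... | no w₁≢w₂  = contradiction (begin-strict
      r + r                    ≤⟨ moats-apart in₁ in₂ w₁≢w₂ (stop refl) ⟩
      δ w₁ x + (0ℚ + δ w₂ x)   ≡⟨ cong (_+_ (δ w₁ x)) (ℚ.+-identityˡ (δ w₂ x)) ⟩
      δ w₁ x + δ w₂ x          <⟨ ℚ.+-mono-< (proj₂ in₁) (proj₂ in₂) ⟩
      r + r                    ∎) (ℚ.<-irrefl refl)
      where open ≤-Reasoning

    module _ (e : Fin m) where

      private
        a b : Fin n
        a = proj₁ (ends G e)
        b = proj₂ (ends G e)

        g : Fin n → ℚ
        g = restrict W (λ w → charge w e)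

        outside : ∀ {x w} → W ‼ w ≡ true → ¬ InMoat x w → r - δ w x ≤ 0ℚ
        outside w∈W ∉moat = ≤⇒-≤0 (ℚ.≮⇒≥ (∉moat ∘ (w∈W ,_)))

        g≤cost : ∀ w → g w ≤ cost G e
        g≤cost w = restrict-≤ W (λ w → charge w e) (cost≥0 G e) (λ _ → ℚ.p⊓q≤p (cost G e) _)

        g≤0 : ∀ {w} → ¬ InMoat a w → ¬ InMoat b w → g w ≤ 0ℚ
        g≤0 ∉a ∉b = restrict-≤ W (λ w → charge w e) ℚ.≤-refl λ w∈W →
          ℚ.≤-trans (ℚ.p⊓q≤q (cost G e) _) (ℚ.+-mono-≤ (outside w∈W ∉a) (outside w∈W ∉b))

        g≤moatA : ∀ {w} → InMoat a w → ¬ InMoat b w → g w ≤ r - δ w a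
        g≤moatA {w} (w∈W , _) ∉b = begin
          g w                            ≡⟨ restrict-∈ W (λ w → charge w e) w∈W ⟩
          charge w e                     ≤⟨ ℚ.p⊓q≤q (cost G e) _ ⟩
          (r - δ w a) + (r - δ w b)      ≤⟨ ℚ.+-monoʳ-≤ (r - δ w a) (outside w∈W ∉b) ⟩
          (r - δ w a) + 0ℚ               ≡⟨ ℚ.+-identityʳ (r - δ w a) ⟩
          r - δ w a                      ∎
          where open ≤-Reasoning

        g≤moatB : ∀ {w} → ¬ InMoat a w → InMoat b w → g w ≤ r - δ w b
        g≤moatB {w} ∉a (w∈W , _) = begin
          g w                            ≡⟨ restrict-∈ W (λ w → charge w e) w∈W ⟩
          charge w e                     ≤⟨ ℚ.p⊓q≤q (cost G e) _ ⟩
          (r - δ w a) + (r - δ w b)      ≤⟨ ℚ.+-monoˡ-≤ (r - δ w b) (outside w∈W ∉a) ⟩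
          0ℚ + (r - δ w b)               ≡⟨ ℚ.+-identityˡ (r - δ w b) ⟩
          r - δ w b                      ∎
          where open ≤-Reasoning

        moats-apart-across : ∀ {w₁ w₂} → InMoat a w₁ → InMoat b w₂ → w₁ ≢ w₂ →
                             (r - δ w₁ a) + (r - δ w₂ b) ≤ cost G e
        moats-apart-across {w₁} {w₂} in₁ in₂ w₁≢w₂ = subst (_≤ cost G e)
          (solve 3 (λ r x y → (r :+ r) :- (x :+ y) := (r :- x) :+ (r :- y)) refl r (δ w₁ a) (δ w₂ b))
          (≤+⇒-≤ (subst (r + r ≤_)
            (solve 3 (λ x c y → x :+ ((c :+ con 0ℚ) :+ y) := (x :+ y) :+ c) refl (δ w₁ a) (cost G e) (δ w₂ b))
            (moats-apart in₁ in₂ w₁≢w₂ (step refl tt (inj₁ refl) (stop refl)))))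

        only : ∀ w₀ → (∀ w → w ≢ w₀ → g w ≤ 0ℚ) → sum g ≤ cost G e
        only w₀ g≤0 = ℚ.≤-trans (sum-≤-at w₀ g≤0) (g≤cost w₀)

        inMoat? : ∀ x w → Dec (InMoat x w)
        inMoat? x w = (W ‼ w Bool.≟ true) ×-dec (δ w x ℚ.<? r)

      -- Moats are disjoint, so at most one contains a and at most one contains b;
      -- when neither is covered, a merely serves as some vertex to single out.
      edgeCharge≤cost : sum (restrict W (λ w → charge w e)) ≤ cost G e
      edgeCharge≤cost with Fin.any? (inMoat? a) | Fin.any? (inMoat? b)
      ... | no ∄a          | no ∄b          = only a (λ w _ → g≤0 (∄a ∘ (w ,_)) (∄b ∘ (w ,_)))
      ... | yes (w₁ , in₁) | no ∄b          = only w₁ (λ w w≢w₁ → g≤0 (w≢w₁ ∘ flip moat-unique in₁) (∄b ∘ (w ,_)))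
      ... | no ∄a          | yes (w₂ , in₂) = only w₂ (λ w w≢w₂ → g≤0 (∄a ∘ (w ,_)) (w≢w₂ ∘ flip moat-unique in₂))
      ... | yes (w₁ , in₁) | yes (w₂ , in₂) with w₁ Fin.≟ w₂
      ...   | yes refl  = only w₁ (λ w w≢w₁ → g≤0 (w≢w₁ ∘ flip moat-unique in₁) (w≢w₁ ∘ flip moat-unique in₂))
      ...   | no w₁≢w₂ = begin
        sum g                          ≤⟨ sum-≤-pair w₁≢w₂ (λ w w≢w₁ w≢w₂ →
                                            g≤0 (w≢w₁ ∘ flip moat-unique in₁) (w≢w₂ ∘ flip moat-unique in₂)) ⟩
        g w₁ + g w₂                    ≤⟨ ℚ.+-mono-≤ (g≤moatA in₁ (w₁≢w₂ ∘ flip moat-unique in₂))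
                                                     (g≤moatB (w₁≢w₂ ∘ moat-unique in₁) in₂) ⟩
        (r - δ w₁ a) + (r - δ w₂ b)    ≤⟨ moats-apart-across in₁ in₂ w₁≢w₂ ⟩
        cost G e                       ∎
        where open ≤-Reasoning

  endpoint-escapes : ∀ {F s t w} → w ≡ s ⊎ w ≡ t → ∃ (WalkIn (λ e → F ‼ e ≡ true) s t) →
                     (∀ {es} → WalkG G s t es → r ≤ walkCost G es) → Escapes F w
  endpoint-escapes (inj₁ refl) path far = _ , path , far
  endpoint-escapes (inj₂ refl) (_ , path) far =
    _ , (proj₁ (reverse path) , proj₁ (proj₂ (reverse path))) ,
    λ walk → let (_ , walk⁻¹ , cost≡) = reverse walk in subst (r ≤_) cost≡ (far walk⁻¹)

  moatLowerBound : ∀ (F : Subset m) {W : Subset n} → Separated (r + r) W →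
                   (∀ {w} → W ‼ w ≡ true → Escapes F w) → (+ ∣ W ∣ / 1) * r ≤ edgeSetCost G F
  moatLowerBound F {W} separated escapes = begin
    (+ ∣ W ∣ / 1) * r                                             ≡⟨ sum-restrict-const W r ⟨
    sum (restrict W (λ _ → r))
      ≤⟨ sum-mono-≤ (restrict-mono-≤ W λ _ w∈W → radius≤forestCharge {F} (escapes w∈W)) ⟩
    sum (restrict W (λ w → sum (restrict F (charge w))))          ≡⟨ sum-restrict-comm W F charge ⟩
    sum (restrict F (λ e → sum (restrict W (λ w → charge w e))))
      ≤⟨ sum-mono-≤ (restrict-mono-≤ F λ e _ → edgeCharge≤cost {W} separated e) ⟩
    sum (restrict F (cost G))                                     ≡⟨ sumℚ-allFin (restrict F (cost G)) ⟨
    edgeSetCost G F                                               ∎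
    where open ≤-Reasoning

module ProcedureInvariant {n m : ℕ} (G : Graph n m) (U : List (Pair n)) (farThr nearThr : ℚ) where

  open Procedure G U farThr nearThr
  open Walks G

  ¬Near⇒far : ∀ {v w} → ¬ Near v w → ∀ {es} → WalkG G v w es → nearThr ≤ walkCost G es
  ¬Near⇒far {v} {w} ¬near {es} walk with shortestWalk v w
  ... | inj₁ none = contradiction walk (none es)
  ... | inj₂ (es₀ , walk₀ , least) with walkCost G es₀ ℚ.<? nearThr
  ...   | yes close = contradiction (fin _ , finite es₀ walk₀ refl (λ _ → least) , fin<fin close) ¬near
  ...   | no ≮thr   = ℚ.≤-trans (ℚ.≮⇒≥ ≮thr) (least walk)

  Far⇒far : ∀ {P s t} → Far P s t → ∀ {es} → WalkG G s t es → farThr < walkCost G es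
  Far⇒far (fin q , finite _ _ _ least , fin<fin thr<q) walk = ℚ.<-≤-trans thr<q (least _ (liftToQuotient walk))
  Far⇒far (∞ , infinite none , _)                       walk = contradiction (liftToQuotient walk) (none _)

  Anchored : List (Pair n) → Subset n → Set
  Anchored Sr W = ∀ {w} → W ‼ w ≡ true → ∃ λ s → ∃ λ t → (s , t) ∈ Sr × (w ≡ s ⊎ w ≡ t) ×
                  (∀ {es} → WalkG G s t es → farThr < walkCost G es)

  record Invariant (σ : State n) : Set where
    field
      separated : Separated nearThr (Wv σ)
      anchored  : Anchored (Sr σ) (Wv σ)

  Handle-⊆ : ∀ {v Sf W Sf′ W′} → Handle v Sf W Sf′ W′ → ∀ {x} → W′ ‼ x ≡ true → W ‼ x ≡ true ⊎ x ≡ v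
  Handle-⊆ (attach _ _)          = inj₁
  Handle-⊆ (newW {W = W} _) {x} = ∈-∪⁅⁆⁻ W _

  Handle-separated : ∀ {v Sf W Sf′ W′} → Handle v Sf W Sf′ W′ → Separated nearThr W → Separated nearThr W′
  Handle-separated (attach _ _) separated = separated
  Handle-separated {v} (newW {W = W} ¬near) separated w∈ w′∈ w≢w′ walk
    with ∈-∪⁅⁆⁻ W v w∈ | ∈-∪⁅⁆⁻ W v w′∈
  ... | inj₁ w∈W  | inj₁ w′∈W = separated w∈W w′∈W w≢w′ walk
  ... | inj₁ w∈W  | inj₂ refl = let (_ , walk⁻¹ , cost≡) = reverse walk in
    subst (nearThr ≤_) cost≡ (¬Near⇒far (¬near _ w∈W) walk⁻¹)
  ... | inj₂ refl | inj₁ w′∈W = ¬Near⇒far (¬near _ w′∈W) walk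
  ... | inj₂ refl | inj₂ refl = contradiction refl w≢w′

  Step-invariant : ∀ {σ σ′} → Step σ σ′ → Invariant σ → Invariant σ′
  Step-invariant (iter {Sr} {W₂ = W₂} {s = s} {t} _ far handle₁ handle₂) inv = record
    { separated = Handle-separated handle₂ (Handle-separated handle₁ separated)
    ; anchored  = anchored′ }
    where
    open Invariant inv
    new : (s , t) ∈ Sr ++ (s , t) ∷ []
    new = ∈-++⁺ʳ Sr (here refl)
    anchored′ : Anchored (Sr ++ (s , t) ∷ []) W₂
    anchored′ {w} w∈ with Handle-⊆ handle₂ {w} w∈
    ... | inj₂ refl = s , t , new , inj₂ refl , Far⇒far far
    ... | inj₁ w∈₁ with Handle-⊆ handle₁ {w} w∈₁
    ...   | inj₂ refl = s , t , new , inj₁ refl , Far⇒far far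
    ...   | inj₁ w∈₀  = let (s′ , t′ , old , endpoint , far′) = anchored w∈₀ in
                        s′ , t′ , ∈-++⁺ˡ old , endpoint , far′

  Reachable⇒Invariant : ∀ {σ} → Reachable σ → Invariant σ
  Reachable⇒Invariant = go (record { separated = λ {w} w∈ → ∉⊥ w w∈ ; anchored = λ {w} w∈ → ∉⊥ w w∈ })
    where
    ∉⊥ : ∀ {A : Set} w → ⊥ ‼ w ≡ true → A
    ∉⊥ w w∈ = contradiction (trans (sym (lookup-replicate w false)) w∈) λ ()
    go : ∀ {σ σ′} → Invariant σ → Star Step σ σ′ → Invariant σ′
    go inv ε           = inv
    go inv (s ◅ steps) = go (Step-invariant s inv) steps

radius-double : ∀ k .{{_ : NonZero k}} T γ → (γ * ½) * (T per k) + (γ * ½) * (T per k) ≡ (γ * T) per k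
radius-double k T γ = trans
  (solve 4 (λ g h t i → g :* h :* (t :* i) :+ g :* h :* (t :* i) := g :* t :* i :* (h :+ h)) refl γ ½ T (+ 1 / k))
  (ℚ.*-identityʳ _)

radius≤far : ∀ k .{{_ : NonZero k}} {T β γ} → 0ℚ < T → 0ℚ < γ → γ ≤ β * ½ →
             (γ * ½) * (T per k) ≤ (β * T) per k
radius≤far k {T} {β} {γ} 0<T 0<γ γ≤β/2 = begin
  r                  ≤⟨ x≤x+y (ℚ.nonNegative⁻¹ r {{ℚ.nonNeg*nonNeg⇒nonNeg (γ * ½) (T per k)}}) ⟩
  r + r              ≡⟨ radius-double k T γ ⟩
  γ * T * (+ 1 / k)  ≤⟨ ℚ.*-monoʳ-≤-nonNeg (+ 1 / k) (ℚ.*-monoʳ-≤-nonNeg T γ≤β) ⟩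
  β * T * (+ 1 / k)  ∎
  where
  open ≤-Reasoning
  r : ℚ
  r = (γ * ½) * (T per k)
  instance
    1/k-nonNeg : ℚ.NonNegative (+ 1 / k)
    1/k-nonNeg = ℚ.normalize-nonNeg 1 k
    T-nonNeg : ℚ.NonNegative T
    T-nonNeg = ℚ.nonNegative (ℚ.<⇒≤ 0<T)
    γ-nonNeg : ℚ.NonNegative γ
    γ-nonNeg = ℚ.nonNegative (ℚ.<⇒≤ 0<γ)
    γ/2-nonNeg : ℚ.NonNegative (γ * ½)
    γ/2-nonNeg = ℚ.nonNeg*nonNeg⇒nonNeg γ ½
    T/k-nonNeg : ℚ.NonNegative (T per k)
    T/k-nonNeg = ℚ.nonNeg*nonNeg⇒nonNeg T (+ 1 / k)
  γ≤β : γ ≤ β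
  γ≤β = ℚ.≤-trans γ≤β/2 (subst (β * ½ ≤_) (solve 1 (λ b → b :* con ½ :+ b :* con ½ := b) refl β)
                           (x≤x+y (ℚ.≤-trans (ℚ.<⇒≤ 0<γ) γ≤β/2)))

mainTheorem10 : ∀ {n m : ℕ} (G : Graph n m) (U : List (Pair n))
    (k : ℕ) .{{_ : NonZero k}} (T β γ : ℚ) →
    0ℚ < T → 0ℚ < β → 0ℚ < γ → γ ≤ β * ½ →
    (σ : State n) →
    Procedure.Reachable G U ((β * T) per k) ((γ * T) per k) σ →
    Procedure.Terminated G U ((β * T) per k) ((γ * T) per k) σ →
    (F : Subset m) → SteinerForest G (Sr σ) F →
    ((+ ∣ Wv σ ∣ / 1) * (γ * ½) * (T per k)) ≤ edgeSetCost G F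
mainTheorem10 G U k T β γ 0<T _ 0<γ γ≤β/2 σ reachable _ F forest = begin
  (+ ∣ Wv σ ∣ / 1) * (γ * ½) * (T per k)  ≡⟨ ℚ.*-assoc (+ ∣ Wv σ ∣ / 1) (γ * ½) (T per k) ⟩
  (+ ∣ Wv σ ∣ / 1) * r                    ≤⟨ moatLowerBound F {Wv σ} separated′ escapes ⟩
  edgeSetCost G F                         ∎
  where
  -- The bound holds in every reachable state.
  open ≤-Reasoning
  r : ℚ
  r = (γ * ½) * (T per k)
  open Walks G
  open Moats G r
  open ProcedureInvariant G U ((β * T) per k) ((γ * T) per k)
  open Invariant (Reachable⇒Invariant reachable)

  separated′ : Separated (r + r) (Wv σ)
  separated′ = subst (λ d → Separated d (Wv σ)) (sym (radius-double k T γ)) separated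

  escapes : ∀ {w} → Wv σ ‼ w ≡ true → Escapes F w
  escapes w∈W = let (s , t , st∈Sr , endpoint , far) = anchored w∈W in
    endpoint-escapes {F} endpoint (forest st∈Sr)
      (λ walk → ℚ.<⇒≤ (ℚ.≤-<-trans (radius≤far k {β = β} 0<T 0<γ γ≤β/2) (far walk)))
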